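{- For any primes $p, q$ and every positive integer $n$, $S_q(p^n) \geq \|p^n\| - n\, q \log_q p$.
   Context: For a positive integer $m$, $\|m\|$ denotes the minimum number of occurrences of the constant $1$ in an arithmetic expression built only from the constant $1$, addition, multiplication and parentheses whose value is $m$. For an integer base $q\ge 2$, $S_q(m)$ denotes the sum of the digits of the canonical base-$q$ representation of $m$. -}

module Defs where

open import Data.Nat using (ℕ; zero; suc; _+_; _*_; _≤_; _/_; _%_)
open import Data.Product using (Σ; _×_)
open import Relation.Binary.PropositionalEquality using (_≡_)

data Expr : Set where
  one  : Expr
  _⊕_  : Expr → Expr → Expr
  _⊗_  : Expr → Expr → Expr

value : Expr → ℕ
value one       = 1
value (e ⊕ f)   = value e + value f
value (e ⊗ f)   = value e * value f

ones : Expr → ℕ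
ones one       = 1
ones (e ⊕ f)   = ones e + ones f
ones (e ⊗ f)   = ones e + ones f

-- IsComplexity m k  :  k = ‖m‖, the minimum number of ones over all
-- expressions of value m.
IsComplexity : ℕ → ℕ → Set
IsComplexity m k =
  Σ Expr (λ e → value e ≡ m × ones e ≡ k) × ((e : Expr) → value e ≡ m → k ≤ ones e)

-- digit sum of m in base (2 + b), with fuel (fuel m suffices).
digitSumAux : ℕ → ℕ → ℕ → ℕ
digitSumAux zero       b m = 0
digitSumAux (suc fuel) b m = m % (2 + b) + digitSumAux fuel b (m / (2 + b))

-- S q m : sum of base-q digits of m (junk value 0 for q < 2).
S : ℕ → ℕ → ℕ
S zero          m = 0
S (suc zero)    m = 0
S (suc (suc b)) m = digitSumAux m b m

{-# OPTIONS --safe #-}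
-- Horner's scheme writes m = (⋯((d_L q + d_{L-1}) q + d_{L-2}) ⋯) q + d_0 with
-- d_L ≠ 0, i.e. q ^ L ≤ m.  Spelling each q and each digit d as 1 + ⋯ + 1 uses
-- L q + S_q(m) ones, so ‖m‖ ∸ S_q(m) ≤ L q and q ^ (‖m‖ ∸ S_q(m)) ≤ (q ^ L) ^ q ≤ m ^ q.
module Submission where

open import Defs
open import Data.Nat using (ℕ; _*_; _^_; _≤_; _∸_)
open import Data.Nat.Primality using (Prime)
open import Data.Nat.Base
  using (zero; suc; _+_; _<_; _/_; _%_; z≤n; s≤s; nonTrivial⇒n>1)
open import Data.Nat.Primality using (prime⇒nonZero; prime⇒nonTrivial)
open import Data.Nat.Properties
open import Data.Nat.DivMod using (m≡m%n+[m/n]*n; m/n<m; m<n⇒m%n≡m; m≥n⇒m/n>0)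
open import Data.Nat.Tactic.RingSolver using (solve-∀)
open import Data.Product using (_,_)
open import Relation.Nullary using (yes; no; contradiction)
open import Relation.Binary.PropositionalEquality using (_≡_; refl; sym; cong; cong₂)

unary : ℕ → Expr
unary zero    = one
unary (suc n) = one ⊕ unary n

value-unary : ∀ n → value (unary n) ≡ suc n
value-unary zero    = refl
value-unary (suc n) = cong suc (value-unary n)

ones-unary : ∀ n → ones (unary n) ≡ suc n
ones-unary zero    = refl
ones-unary (suc n) = cong suc (ones-unary n)

infixl 5 _⊕ⁿ_

_⊕ⁿ_ : Expr → ℕ → Expr
e ⊕ⁿ zero  = e
e ⊕ⁿ suc r = e ⊕ unary r

value-⊕ⁿ : ∀ e r → value (e ⊕ⁿ r) ≡ value e + r
value-⊕ⁿ e zero    = sym (+-identityʳ (value e))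
value-⊕ⁿ e (suc r) = cong (value e +_) (value-unary r)

ones-⊕ⁿ : ∀ e r → ones (e ⊕ⁿ r) ≡ ones e + r
ones-⊕ⁿ e zero    = sym (+-identityʳ (ones e))
ones-⊕ⁿ e (suc r) = cong (ones e +_) (ones-unary r)

-- The base is 2 + b; the fuelled digitSumAux f b m is the true digit sum S (2 + b) m once m ≤ f.
record HornerExpr (b f m : ℕ) : Set where
  constructor hornerExpr
  field
    height       : ℕ
    expr         : Expr
    value≡       : value expr ≡ m
    base^height≤ : (2 + b) ^ height ≤ m
    ones≤        : ones expr ≤ digitSumAux f b m + height * (2 + b)

module _ {b : ℕ} where

  private
    q : ℕ
    q = 2 + b

  hornerExpr-digit : ∀ {f m} → suc m < q → HornerExpr b (suc f) (suc m)
  hornerExpr-digit {f} {m} m<q =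
    hornerExpr 0 (unary m) (value-unary m) (s≤s z≤n) (begin
      ones (unary m)                              ≡⟨ ones-unary m ⟩
      suc m                                       ≡⟨ sym (m<n⇒m%n≡m m<q) ⟩
      suc m % q                                   ≤⟨ m≤m+n _ _ ⟩
      suc m % q + digitSumAux f b (suc m / q)     ≡⟨ sym (+-identityʳ _) ⟩
      suc m % q + digitSumAux f b (suc m / q) + 0 ∎)
    where open ≤-Reasoning

  hornerExpr-step : ∀ {f m} → HornerExpr b f (m / q) → HornerExpr b (suc f) m
  hornerExpr-step {f} {m} (hornerExpr L e value≡ q^L≤ ones≤) =
    hornerExpr (suc L) (e ⊗ unary (suc b) ⊕ⁿ r) value≡′ q^1+L≤ ones≤′
    where
    r : ℕ
    r = m % q
    open ≤-Reasoning

    value≡′ : value (e ⊗ unary (suc b) ⊕ⁿ r) ≡ m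
    value≡′ = begin-equality
      value (e ⊗ unary (suc b) ⊕ⁿ r)      ≡⟨ value-⊕ⁿ _ r ⟩
      value e * value (unary (suc b)) + r ≡⟨ cong (_+ r) (cong₂ _*_ value≡ (value-unary (suc b))) ⟩
      m / q * q + r                       ≡⟨ +-comm _ r ⟩
      r + m / q * q                       ≡⟨ sym (m≡m%n+[m/n]*n m q) ⟩
      m                                   ∎

    q^1+L≤ : q ^ suc L ≤ m
    q^1+L≤ = begin
      q * q ^ L     ≤⟨ *-monoʳ-≤ q q^L≤ ⟩
      q * (m / q)   ≡⟨ *-comm q (m / q) ⟩
      m / q * q     ≤⟨ m≤n+m _ r ⟩
      r + m / q * q ≡⟨ sym (m≡m%n+[m/n]*n m q) ⟩
      m             ∎

    ones≤′ : ones (e ⊗ unary (suc b) ⊕ⁿ r) ≤ r + digitSumAux f b (m / q) + suc L * q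
    ones≤′ = begin
      ones (e ⊗ unary (suc b) ⊕ⁿ r)           ≡⟨ ones-⊕ⁿ _ r ⟩
      ones e + ones (unary (suc b)) + r       ≡⟨ cong (λ x → ones e + x + r) (ones-unary (suc b)) ⟩
      ones e + q + r                          ≤⟨ +-monoˡ-≤ r (+-monoˡ-≤ q ones≤) ⟩
      digitSumAux f b (m / q) + L * q + q + r ≡⟨ rearrange r (digitSumAux f b (m / q)) (L * q) q ⟩
      r + digitSumAux f b (m / q) + suc L * q ∎
      where
      rearrange : ∀ r s a c → s + a + c + r ≡ r + s + (c + a)
      rearrange = solve-∀

  hornerExpr-exists : ∀ f m → 1 ≤ m → m ≤ f → HornerExpr b f m
  hornerExpr-exists zero    m         1≤m m≤0   = contradiction (≤-trans 1≤m m≤0) λ ()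
  hornerExpr-exists (suc f) m@(suc _) _   m≤1+f with m <? q
  ... | yes m<q = hornerExpr-digit m<q
  ... | no  m≮q = hornerExpr-step
    (hornerExpr-exists f (m / q) (m≥n⇒m/n>0 (≮⇒≥ m≮q))
      (≤-pred (≤-trans (m/n<m m q (s≤s (s≤s z≤n))) m≤1+f)))

base^[complexity∸digitSum]≤^base : ∀ {q m k} → 2 ≤ q → 1 ≤ m → IsComplexity m k →
  q ^ (k ∸ S q m) ≤ m ^ q
base^[complexity∸digitSum]≤^base {q} {m} {k} (s≤s (s≤s _)) 1≤m (_ , minimal) = begin
  q ^ (k ∸ S q m)   ≤⟨ ^-monoʳ-≤ q k∸S≤Lq ⟩
  q ^ (L * q)       ≡⟨ sym (^-*-assoc q L q) ⟩
  (q ^ L) ^ q       ≤⟨ ^-monoˡ-≤ q base^height≤ ⟩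
  m ^ q             ∎
  where
  open ≤-Reasoning
  open HornerExpr (hornerExpr-exists m m 1≤m ≤-refl) renaming (height to L)

  k∸S≤Lq : k ∸ S q m ≤ L * q
  k∸S≤Lq = m≤n+o⇒m∸n≤o k (S q m) (≤-trans (minimal expr value≡) ones≤)

proposition1 : (p q n k : ℕ) → Prime p → Prime q → 1 ≤ n →
    IsComplexity (p ^ n) k →
    q ^ (k ∸ S q (p ^ n)) ≤ p ^ (n * q)
proposition1 p q n k pp pq _ complexity = begin
  q ^ (k ∸ S q (p ^ n)) ≤⟨ base^[complexity∸digitSum]≤^base 2≤q (m^n>0 p {{prime⇒nonZero pp}} n) complexity ⟩
  (p ^ n) ^ q           ≡⟨ ^-*-assoc p n q ⟩
  p ^ (n * q)           ∎
  where
  open ≤-Reasoning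
  2≤q : 2 ≤ q
  2≤q = nonTrivial⇒n>1 q {{prime⇒nonTrivial pq}}
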